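{- Let $n\ge 1$ and $T\in\mathbb{T}_n$. Then $T$ is the maximum element of $\mathbb{T}_n$ (i.e. $T'\le T$ for every $T'\in\mathbb{T}_n$) if and only if $T$ contains no pivot node, i.e. if and only if every node of $T$ is exhausted.
   Context: Let $\mathbb{T}$ be the set of finite rooted trees in which every internal node has at least two children. For a node $v$, $T(v)$ is the subtree rooted at $v$ and $l(v)$ the number of leaves of $T(v)$; $\mathbb{T}_n=\{T\in\mathbb{T}:l(\mathrm{root}(T))=n\}$. For an integer $p\ge 2$, $\mathrm{Part}(p)$ is the set of non-decreasing sequences $(a_1,\dots,a_k)$ of positive integers with $k\ge 2$ and $\sum_i a_i=p$, ordered lexicographically: for distinct $a=(a_i)_k$, $b=(b_i)_m$, let $j$ be the least index $\le\min\{k,m\}$ with $a_j\ne b_j$; then $a<b$ iff $a_j<b_j$. Its maximum element is $(\lfloor p/2\rfloor,\lceil p/2\rceil)$. Node comparison: define, by induction on the number of leaves, a comparison between nodes $v,w$ (of the same or different trees of $\mathbb{T}$) with outcomes $v<w$, $v\sim w$, or $w<v$: (1) if $l(v)<l(w)$ then $v<w$ (symmetrically if $l(w)<l(v)$); (2) if $l(v)=l(w)=1$ then $v\sim w$; (3) if $l(v)=l(w)\ge 2$, list the children of $v$ as $v_1,\dots,v_k$ and those of $w$ as $w_1,\dots,w_m$, each list non-decreasing with respect to this comparison (already defined for them); $(l(v_1),\dots,l(v_k))$ and $(l(w_1),\dots,l(w_m))\in\mathrm{Part}(l(v))$ are the partitions induced by $v$ and $w$. (3.1) If the partition induced by $v$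 is lexicographically smaller (resp. larger) than the one induced by $w$ then $v<w$ (resp. $w<v$). (3.2) If they are equal (so $k=m$): if $v_i\sim w_i$ for all $i$ then $v\sim w$; otherwise, with $j$ least such that $v_j\not\sim w_j$, $v<w$ if $v_j<w_j$ and $w<v$ otherwise. Write $v\le w$ if $v<w$ or $v\sim w$. For $T_1,T_2\in\mathbb{T}_n$ write $T_1<T_2$, $T_1\sim T_2$, $T_1\le T_2$ according to the comparison of their roots. A node $v$ is exhausted if it is a leaf or the partition induced by $v$ is the maximum $(\lfloor l(v)/2\rfloor,\lceil l(v)/2\rceil)$ of $\mathrm{Part}(l(v))$. When the children of each node are arranged in non-decreasing order $v_1\le\dots\le v_k$, the inverted post-order traversal traverses $T(v_k),T(v_{k-1}),\dots,T(v_1)$ recursively and then visits the root; the pivot of $T$ is the first node in this traversal that is not exhausted, if one exists. -}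

module Defs where

open import Data.Nat using (ℕ; zero; suc; _+_; _≤_; _<_; _≟_; ⌊_/2⌋; ⌈_/2⌉)
open import Data.Nat.Properties using (<-cmp)
open import Data.List using (List; []; _∷_; length; map)
open import Data.List.Relation.Unary.All using (All)
open import Data.Unit using (⊤)
open import Data.Empty using (⊥)
open import Relation.Binary.PropositionalEquality using (_≡_; _≢_)
open import Relation.Binary.Definitions using (tri<; tri≈; tri>)

data Cmp : Set where
  lt eq gt : Cmp

-- Rooted trees with an (arbitrary) list of children; the order of the
-- list carries no meaning: the comparison sorts children itself.
data Tree : Set where
  leaf : Tree
  node : List Tree → Tree

-- Membership in 𝕋: every internal node has at least two children.
data WF : Tree → Set where
  wfLeaf : WF leaf
  wfNode : {ts : List Tree} → 2 ≤ length ts → All WF ts → WF (node ts)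

mutual
  leaves : Tree → ℕ
  leaves leaf = 1
  leaves (node ts) = leavesL ts

  leavesL : List Tree → ℕ
  leavesL [] = 0
  leavesL (t ∷ ts) = leaves t + leavesL ts

mutual
  height : Tree → ℕ
  height leaf = 0
  height (node ts) = suc (heightL ts)

  heightL : List Tree → ℕ
  heightL [] = 0
  heightL (t ∷ ts) = height t Data.Nat.⊔ heightL ts

cmpℕ : ℕ → ℕ → Cmp
cmpℕ m n with <-cmp m n
... | tri< _ _ _ = lt
... | tri≈ _ _ _ = eq
... | tri> _ _ _ = gt

insertWith : {A : Set} → (A → A → Cmp) → A → List A → List A
insertWith c x [] = x ∷ []
insertWith c x (y ∷ ys) with c x y
... | gt = y ∷ insertWith c x ys
... | _  = x ∷ y ∷ ys

sortWith : {A : Set} → (A → A → Cmp) → List A → List A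
sortWith c [] = []
sortWith c (x ∷ xs) = insertWith c x (sortWith c xs)

lexWith : {A : Set} → (A → A → Cmp) → List A → List A → Cmp
lexWith c [] [] = eq
lexWith c [] (_ ∷ _) = lt
lexWith c (_ ∷ _) [] = gt
lexWith c (x ∷ xs) (y ∷ ys) with c x y
... | eq = lexWith c xs ys
... | o  = o

-- Node comparison, with a fuel parameter bounding the recursion depth
-- (the paper's induction on the number of leaves).
thenCmp : Cmp → Cmp → Cmp
thenCmp eq o = o
thenCmp lt _ = lt
thenCmp gt _ = gt

cmpF : ℕ → Tree → Tree → Cmp
cmpF zero _ _ = eq
cmpF (suc k) v w with cmpℕ (leaves v) (leaves w)
... | lt = lt
... | gt = gt
cmpF (suc k) leaf leaf | eq = eq
cmpF (suc k) leaf (node _) | eq = eq        -- impossible for trees in 𝕋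
cmpF (suc k) (node _) leaf | eq = eq        -- impossible for trees in 𝕋
cmpF (suc k) (node ts) (node us) | eq =
  let vs = sortWith (cmpF k) ts
      ws = sortWith (cmpF k) us
  in thenCmp (lexWith cmpℕ (map leaves vs) (map leaves ws))
             (lexWith (cmpF k) vs ws)

-- The comparison of nodes (roots of subtrees); fuel is sufficient.
cmpT : Tree → Tree → Cmp
cmpT v w = cmpF (suc (height v + height w)) v w

_≤T_ : Tree → Tree → Set
v ≤T w = cmpT v w ≢ gt

sortedChildren : List Tree → List Tree
sortedChildren = sortWith cmpT

inducedPartition : List Tree → List ℕ
inducedPartition ts = map leaves (sortedChildren ts)

Exhausted : Tree → Set
Exhausted leaf = ⊤
Exhausted (node ts) =
  inducedPartition ts ≡ ⌊ leavesL ts /2⌋ ∷ ⌈ leavesL ts /2⌉ ∷ []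

data Every (P : Tree → Set) : Tree → Set where
  everyLeaf : P leaf → Every P leaf
  everyNode : {ts : List Tree} → P (node ts) → All (Every P) ts → Every P (node ts)

-- Compare an arbitrary tree T with a tree Z that is exhausted everywhere and
-- has as many leaves. At the roots, Z induces the lexicographically largest
-- partition (⌊n/2⌋, ⌈n/2⌉); if T induces a different partition then Z > T,
-- and otherwise the sorted children are compared pairwise, where the same
-- dichotomy holds by induction. Hence Z ≥ T, with equality only if T is
-- itself exhausted everywhere. Since an everywhere exhausted tree exists for
-- every n ≥ 1 (split the leaves in halves recursively), a maximum tree must be
-- exhausted everywhere, and an everywhere exhausted tree is a maximum.
module Submission where

open import Defs
open import Data.Nat using (ℕ; zero; suc; _+_; _≤_; _<_; z≤n; s≤s; ⌊_/2⌋; ⌈_/2⌉)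
open import Data.Nat.Properties
open import Data.Nat.ListAction using (sum)
open import Data.Nat.ListAction.Properties using (sum-↭)
open import Data.List using (List; []; _∷_; length; map)
open import Data.List.Properties using (length-map; ∷-injectiveˡ; ∷-injectiveʳ)
open import Data.List.Relation.Unary.All as All using (All; []; _∷_)
open import Data.List.Relation.Unary.All.Properties using () renaming (map⁺ to All-map⁺)
open import Data.List.Relation.Unary.AllPairs using (AllPairs; []; _∷_)
import Data.List.Relation.Unary.AllPairs.Properties as AllPairs
open import Data.List.Relation.Binary.Permutation.Propositional
  using (_↭_; ↭-refl; ↭-prep; ↭-swap; ↭-trans; ↭-sym)
open import Data.List.Relation.Binary.Permutation.Propositional.Properties
  using (All-resp-↭; ↭-length) renaming (map⁺ to ↭-map⁺)
open import Data.Sum as Sum using (_⊎_; inj₁; inj₂)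
open import Data.Product as Product using (_×_; _,_)
open import Data.Empty using (⊥-elim)
open import Data.Unit using (tt)
open import Function using (_on_)
open import Function.Bundles using (_⇔_; mk⇔)
open import Relation.Binary.Definitions using (Transitive; tri<; tri≈; tri>)
open import Relation.Binary.PropositionalEquality
  using (_≡_; _≢_; refl; sym; trans; cong; cong₂; subst; subst₂; module ≡-Reasoning)

flipCmp : Cmp → Cmp
flipCmp lt = gt
flipCmp eq = eq
flipCmp gt = lt

thenCmp-flip : ∀ a b → thenCmp (flipCmp a) (flipCmp b) ≡ flipCmp (thenCmp a b)
thenCmp-flip lt b = refl
thenCmp-flip eq b = refl
thenCmp-flip gt b = refl

lexWith-flip : {A : Set} (c : A → A → Cmp) → (∀ x y → c y x ≡ flipCmp (c x y)) →
               ∀ xs ys → lexWith c ys xs ≡ flipCmp (lexWith c xs ys)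
lexWith-flip c c-flip [] [] = refl
lexWith-flip c c-flip [] (y ∷ ys) = refl
lexWith-flip c c-flip (x ∷ xs) [] = refl
lexWith-flip c c-flip (x ∷ xs) (y ∷ ys) with c x y | c y x | c-flip x y
... | lt | .gt | refl = refl
... | eq | .eq | refl = lexWith-flip c c-flip xs ys
... | gt | .lt | refl = refl

data Ordering (m n : ℕ) : Cmp → Set where
  less    : m < n → Ordering m n lt
  equal   : m ≡ n → Ordering m n eq
  greater : n < m → Ordering m n gt

cmpℕ-ordering : ∀ m n → Ordering m n (cmpℕ m n)
cmpℕ-ordering m n with <-cmp m n
... | tri< m<n _ _ = less m<n
... | tri≈ _ m≡n _ = equal m≡n
... | tri> _ _ n<m = greater n<m

Ordering-unique : ∀ {m n c d} → Ordering m n c → Ordering m n d → c ≡ d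
Ordering-unique (less _)    (less _)    = refl
Ordering-unique (less p)    (equal q)   = ⊥-elim (<-irrefl q p)
Ordering-unique (less p)    (greater q) = ⊥-elim (<-asym p q)
Ordering-unique (equal p)   (less q)    = ⊥-elim (<-irrefl p q)
Ordering-unique (equal _)   (equal _)   = refl
Ordering-unique (equal p)   (greater q) = ⊥-elim (<-irrefl (sym p) q)
Ordering-unique (greater p) (less q)    = ⊥-elim (<-asym p q)
Ordering-unique (greater p) (equal q)   = ⊥-elim (<-irrefl (sym q) p)
Ordering-unique (greater _) (greater _) = refl

cmpℕ-unique : ∀ {m n c} → Ordering m n c → cmpℕ m n ≡ c
cmpℕ-unique {m} {n} = Ordering-unique (cmpℕ-ordering m n)

cmpℕ-flip : ∀ m n → cmpℕ n m ≡ flipCmp (cmpℕ m n)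
cmpℕ-flip m n with cmpℕ m n | cmpℕ-ordering m n
... | lt | less m<n    = cmpℕ-unique (greater m<n)
... | eq | equal m≡n   = cmpℕ-unique (equal (sym m≡n))
... | gt | greater n<m = cmpℕ-unique (less n<m)

lexWith-cmpℕ-refl : ∀ xs → lexWith cmpℕ xs xs ≡ eq
lexWith-cmpℕ-refl [] = refl
lexWith-cmpℕ-refl (x ∷ xs) rewrite cmpℕ-unique (equal {x} refl) = lexWith-cmpℕ-refl xs

module _ {A : Set} (c : A → A → Cmp) where

  insertWith-↭ : ∀ x ys → insertWith c x ys ↭ x ∷ ys
  insertWith-↭ x [] = ↭-refl
  insertWith-↭ x (y ∷ ys) with c x y
  ... | lt = ↭-refl
  ... | eq = ↭-refl
  ... | gt = ↭-trans (↭-prep y (insertWith-↭ x ys)) (↭-swap y x ↭-refl)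

  sortWith-↭ : ∀ xs → sortWith c xs ↭ xs
  sortWith-↭ [] = ↭-refl
  sortWith-↭ (x ∷ xs) = ↭-trans (insertWith-↭ x (sortWith c xs)) (↭-prep x (sortWith-↭ xs))

  All-sortWith⁺ : {P : A → Set} {xs : List A} → All P xs → All P (sortWith c xs)
  All-sortWith⁺ = All-resp-↭ (↭-sym (sortWith-↭ _))

  All-sortWith⁻ : {P : A → Set} {xs : List A} → All P (sortWith c xs) → All P xs
  All-sortWith⁻ = All-resp-↭ (sortWith-↭ _)

  module _ {R : A → A → Set} (R-trans : Transitive R)
           (≢gt⇒R : ∀ {x y} → c x y ≢ gt → R x y) (≡gt⇒R : ∀ {x y} → c x y ≡ gt → R y x) where

    ∷-AllPairs : ∀ {x y ys} → c x y ≢ gt → AllPairs R (y ∷ ys) → AllPairs R (x ∷ y ∷ ys)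
    ∷-AllPairs x≤y y∷ys@(y≤ys ∷ _) = (≢gt⇒R x≤y ∷ All.map (R-trans (≢gt⇒R x≤y)) y≤ys) ∷ y∷ys

    insertWith-AllPairs : ∀ x {ys} → AllPairs R ys → AllPairs R (insertWith c x ys)
    insertWith-AllPairs x {[]} [] = [] ∷ []
    insertWith-AllPairs x {y ∷ ys} y∷ys@(y≤ys ∷ ys-sorted) with c x y in cxy
    ... | lt = ∷-AllPairs (subst (_≢ gt) (sym cxy) λ ()) y∷ys
    ... | eq = ∷-AllPairs (subst (_≢ gt) (sym cxy) λ ()) y∷ys
    ... | gt = All-resp-↭ (↭-sym (insertWith-↭ x ys)) (≡gt⇒R cxy ∷ y≤ys)
               ∷ insertWith-AllPairs x ys-sorted

    sortWith-AllPairs : ∀ xs → AllPairs R (sortWith c xs)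
    sortWith-AllPairs [] = []
    sortWith-AllPairs (x ∷ xs) = insertWith-AllPairs x (sortWith-AllPairs xs)

module _ {A : Set} {P : A → Set} {c c′ : A → A → Cmp}
         (c≗c′ : ∀ {x y} → P x → P y → c x y ≡ c′ x y) where

  insertWith-cong : ∀ {x ys} → P x → All P ys → insertWith c x ys ≡ insertWith c′ x ys
  insertWith-cong {ys = []} px [] = refl
  insertWith-cong {x} {y ∷ ys} px (py ∷ pys) rewrite c≗c′ px py with c′ x y
  ... | lt = refl
  ... | eq = refl
  ... | gt = cong (y ∷_) (insertWith-cong px pys)

  sortWith-cong : ∀ {xs} → All P xs → sortWith c xs ≡ sortWith c′ xs
  sortWith-cong [] = refl
  sortWith-cong (px ∷ pxs) rewrite sortWith-cong pxs = insertWith-cong px (All-sortWith⁺ c′ pxs)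

  lexWith-cong : ∀ {xs ys} → All P xs → All P ys → lexWith c xs ys ≡ lexWith c′ xs ys
  lexWith-cong [] [] = refl
  lexWith-cong [] (_ ∷ _) = refl
  lexWith-cong (_ ∷ _) [] = refl
  lexWith-cong {x ∷ xs} {y ∷ ys} (px ∷ pxs) (py ∷ pys) rewrite c≗c′ px py with c′ x y
  ... | lt = refl
  ... | eq = lexWith-cong pxs pys
  ... | gt = refl

-- The node comparison

cmpF-flip : ∀ k x y → cmpF k y x ≡ flipCmp (cmpF k x y)
cmpF-flip zero x y = refl
cmpF-flip (suc k) x y
  with cmpℕ (leaves x) (leaves y) | cmpℕ (leaves y) (leaves x) | cmpℕ-flip (leaves x) (leaves y)
... | lt | .gt | refl = refl
... | gt | .lt | refl = refl
cmpF-flip (suc k) leaf leaf           | eq | .eq | refl = refl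
cmpF-flip (suc k) leaf (node _)       | eq | .eq | refl = refl
cmpF-flip (suc k) (node _) leaf       | eq | .eq | refl = refl
cmpF-flip (suc k) (node ts) (node us) | eq | .eq | refl =
  trans (cong₂ thenCmp (lexWith-flip cmpℕ cmpℕ-flip (map leaves vs) (map leaves ws))
                       (lexWith-flip (cmpF k) (cmpF-flip k) vs ws))
        (thenCmp-flip (lexWith cmpℕ (map leaves vs) (map leaves ws)) (lexWith (cmpF k) vs ws))
  where
  vs = sortWith (cmpF k) ts
  ws = sortWith (cmpF k) us

cmpT-flip : ∀ x y → cmpT y x ≡ flipCmp (cmpT x y)
cmpT-flip x y rewrite +-comm (height y) (height x) = cmpF-flip _ x y

cmpF-≢gt-leaves : ∀ k x y → cmpF (suc k) x y ≢ gt → leaves x ≤ leaves y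
cmpF-≢gt-leaves k x y x≯y with cmpℕ (leaves x) (leaves y) | cmpℕ-ordering (leaves x) (leaves y)
... | lt | less x<y = <⇒≤ x<y
... | eq | equal x≡y = ≤-reflexive x≡y
... | gt | greater _ = ⊥-elim (x≯y refl)

cmpT-≢gt-leaves : ∀ {x y} → cmpT x y ≢ gt → leaves x ≤ leaves y
cmpT-≢gt-leaves {x} {y} = cmpF-≢gt-leaves _ x y

cmpT-≡gt-leaves : ∀ {x y} → cmpT x y ≡ gt → leaves y ≤ leaves x
cmpT-≡gt-leaves {x} {y} x>y = cmpT-≢gt-leaves {y} {x} y≯x
  where
  y≯x : cmpT y x ≢ gt
  y≯x y>x with () ← trans (sym y>x) (trans (cmpT-flip x y) (cong flipCmp x>y))

height≤heightL : ∀ ts → All (λ t → height t ≤ heightL ts) ts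
height≤heightL [] = []
height≤heightL (t ∷ ts) =
  m≤m⊔n (height t) (heightL ts) ∷ All.map (λ h → ≤-trans h (m≤n⊔m (height t) (heightL ts))) (height≤heightL ts)

children-height< : ∀ {k} ts → heightL ts < k → All (λ t → height t < k) ts
children-height< ts h = All.map (λ t≤ → ≤-<-trans t≤ h) (height≤heightL ts)

cmpF-fuel : ∀ {k k′} x y → height x < k → height y < k → height x < k′ → height y < k′ →
            cmpF k x y ≡ cmpF k′ x y
cmpF-fuel {suc k} {suc k′} x y _ _ _ _ with cmpℕ (leaves x) (leaves y)
... | lt = refl
... | gt = refl
cmpF-fuel {suc k} {suc k′} leaf leaf _ _ _ _ | eq = refl
cmpF-fuel {suc k} {suc k′} leaf (node _) _ _ _ _ | eq = refl
cmpF-fuel {suc k} {suc k′} (node _) leaf _ _ _ _ | eq = refl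
cmpF-fuel {suc k} {suc k′} (node ts) (node us) (s≤s hx) (s≤s hy) (s≤s hx′) (s≤s hy′) | eq =
  cong₂ thenCmp (cong₂ (lexWith cmpℕ) (cong (map leaves) ts-sorted) (cong (map leaves) us-sorted))
                (trans (cong₂ (lexWith (cmpF k)) ts-sorted us-sorted)
                       (lexWith-cong agree (All-sortWith⁺ (cmpF k′) ts-below) (All-sortWith⁺ (cmpF k′) us-below)))
  where
  Below : Tree → Set
  Below t = height t < k × height t < k′
  agree : ∀ {x y} → Below x → Below y → cmpF k x y ≡ cmpF k′ x y
  agree {x} {y} (x<k , x<k′) (y<k , y<k′) = cmpF-fuel x y x<k y<k x<k′ y<k′
  ts-below : All Below ts
  ts-below = All.zip (children-height< ts hx , children-height< ts hx′)
  us-below : All Below us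
  us-below = All.zip (children-height< us hy , children-height< us hy′)
  ts-sorted : sortWith (cmpF k) ts ≡ sortWith (cmpF k′) ts
  ts-sorted = sortWith-cong agree ts-below
  us-sorted : sortWith (cmpF k) us ≡ sortWith (cmpF k′) us
  us-sorted = sortWith-cong agree us-below

cmpF-cmpT : ∀ {k} x y → height x < k → height y < k → cmpF k x y ≡ cmpT x y
cmpF-cmpT x y x<k y<k =
  cmpF-fuel x y x<k y<k (s≤s (m≤m+n (height x) (height y))) (s≤s (m≤n+m (height y) (height x)))

cmpT-node : ∀ ts us → leavesL ts ≡ leavesL us →
            cmpT (node ts) (node us) ≡ thenCmp (lexWith cmpℕ (inducedPartition ts) (inducedPartition us))
                                               (lexWith cmpT (sortedChildren ts) (sortedChildren us))
cmpT-node ts us same with cmpℕ (leavesL ts) (leavesL us) | cmpℕ-unique (equal same)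
... | .eq | refl =
  cong₂ thenCmp (cong₂ (lexWith cmpℕ) (cong (map leaves) ts-sorted) (cong (map leaves) us-sorted))
                (trans (cong₂ (lexWith (cmpF K)) ts-sorted us-sorted)
                       (lexWith-cong agree (All-sortWith⁺ cmpT ts-below) (All-sortWith⁺ cmpT us-below)))
  where
  K = suc (heightL ts) + suc (heightL us)
  Below : Tree → Set
  Below t = height t < K
  agree : ∀ {x y} → Below x → Below y → cmpF K x y ≡ cmpT x y
  agree {x} {y} = cmpF-cmpT x y
  ts-below : All Below ts
  ts-below = children-height< ts (≤-trans (n<1+n _) (m≤m+n _ (suc (heightL us))))
  us-below : All Below us
  us-below = children-height< us (≤-trans (n<1+n _) (m≤n+m _ (suc (heightL ts))))
  ts-sorted : sortWith (cmpF K) ts ≡ sortedChildren ts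
  ts-sorted = sortWith-cong agree ts-below
  us-sorted : sortWith (cmpF K) us ≡ sortedChildren us
  us-sorted = sortWith-cong agree us-below

-- Partitions

record IsPartition (n : ℕ) (p : List ℕ) : Set where
  constructor partition
  field
    nondecreasing : AllPairs _≤_ p
    positive      : All (1 ≤_) p
    two-parts     : 2 ≤ length p
    sum≡          : sum p ≡ n

halves : ℕ → List ℕ
halves n = ⌊ n /2⌋ ∷ ⌈ n /2⌉ ∷ []

m+m≤n⇒m≤⌊n/2⌋ : ∀ {m n} → m + m ≤ n → m ≤ ⌊ n /2⌋
m+m≤n⇒m≤⌊n/2⌋ {m} m+m≤n = ≤-trans (≤-reflexive (n≡⌊n+n/2⌋ m)) (⌊n/2⌋-mono m+m≤n)

⌊n/2⌋+m≡n⇒m≡⌈n/2⌉ : ∀ {m n} → ⌊ n /2⌋ + m ≡ n → m ≡ ⌈ n /2⌉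
⌊n/2⌋+m≡n⇒m≡⌈n/2⌉ {m} {n} sum≡n = +-cancelˡ-≡ ⌊ n /2⌋ m ⌈ n /2⌉ (trans sum≡n (sym (⌊n/2⌋+⌈n/2⌉≡n n)))

halves-greatest : ∀ {n p} → IsPartition n p → p ≡ halves n ⊎ lexWith cmpℕ (halves n) p ≡ gt
halves-greatest {n} {x₁ ∷ x₂ ∷ r} (partition ((x₁≤x₂ ∷ _) ∷ _) (_ ∷ _ ∷ r-positive) (s≤s (s≤s _)) sum≡n)
  with cmpℕ ⌊ n /2⌋ x₁ | cmpℕ-ordering ⌊ n /2⌋ x₁
... | gt | greater _ = inj₂ refl
... | lt | less half<x₁ =
  ⊥-elim (<⇒≱ half<x₁ (m+m≤n⇒m≤⌊n/2⌋ (≤-trans (+-monoʳ-≤ x₁ (≤-trans x₁≤x₂ (m≤m+n x₂ (sum r))))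
                                               (≤-reflexive sum≡n))))
... | eq | equal half≡x₁
  with r | r-positive | ⌊n/2⌋+m≡n⇒m≡⌈n/2⌉ (trans (cong (_+ (x₂ + sum r)) half≡x₁) sum≡n)
...   | []     | []          | x₂+0≡ = inj₁ (cong₂ _∷_ (sym half≡x₁) (cong (_∷ []) (trans (sym (+-identityʳ x₂)) x₂+0≡)))
...   | y ∷ r′ | 1≤y ∷ _     | x₂+rest≡
  rewrite cmpℕ-unique (greater (<-≤-trans (m<m+n x₂ (≤-trans 1≤y (m≤m+n y (sum r′)))) (≤-reflexive x₂+rest≡))) =
  inj₂ refl

leaves-positive : ∀ {t} → WF t → 1 ≤ leaves t
leaves-positive wfLeaf = s≤s z≤n
leaves-positive (wfNode {t ∷ ts} _ (wt ∷ _)) = ≤-trans (leaves-positive wt) (m≤m+n (leaves t) (leavesL ts))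

node-leaves≢1 : ∀ {ts} → WF (node ts) → leavesL ts ≢ 1
node-leaves≢1 (wfNode {t ∷ t′ ∷ ts} (s≤s (s≤s _)) (wt ∷ wt′ ∷ _)) leaves≡1 with s≤s () ←
  ≤-trans (+-mono-≤ (leaves-positive wt) (≤-trans (leaves-positive wt′) (m≤m+n (leaves t′) (leavesL ts))))
          (≤-reflexive leaves≡1)

leavesL≡sum : ∀ ts → leavesL ts ≡ sum (map leaves ts)
leavesL≡sum [] = refl
leavesL≡sum (t ∷ ts) = cong (leaves t +_) (leavesL≡sum ts)

sum-inducedPartition : ∀ ts → sum (inducedPartition ts) ≡ leavesL ts
sum-inducedPartition ts = trans (sum-↭ (↭-map⁺ leaves (sortWith-↭ cmpT ts))) (sym (leavesL≡sum ts))

inducedPartition-isPartition : ∀ {ts} → WF (node ts) → IsPartition (leavesL ts) (inducedPartition ts)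
inducedPartition-isPartition {ts} (wfNode two≤ wts) = partition
  (AllPairs.map⁺ (sortWith-AllPairs cmpT {R = _≤_ on leaves} ≤-trans
                    (λ {x} {y} → cmpT-≢gt-leaves {x} {y}) (λ {x} {y} → cmpT-≡gt-leaves {x} {y}) ts))
  (All-map⁺ (All-sortWith⁺ cmpT (All.map leaves-positive wts)))
  (≤-trans two≤ (≤-reflexive (sym (trans (length-map leaves (sortedChildren ts)) (↭-length (sortWith-↭ cmpT ts))))))
  (sum-inducedPartition ts)

cmpT-node-≡ : ∀ {us ts} → inducedPartition us ≡ inducedPartition ts →
              cmpT (node us) (node ts) ≡ lexWith cmpT (sortedChildren us) (sortedChildren ts)
cmpT-node-≡ {us} {ts} same =
  trans (cmpT-node us ts (trans (sym (sum-inducedPartition us)) (trans (cong sum same) (sum-inducedPartition ts))))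
        (cong (λ o → thenCmp o (lexWith cmpT (sortedChildren us) (sortedChildren ts)))
              (trans (cong (λ p → lexWith cmpℕ p (inducedPartition ts)) same) (lexWith-cmpℕ-refl (inducedPartition ts))))

cmpT-node-> : ∀ {us ts} → leavesL us ≡ leavesL ts →
              lexWith cmpℕ (inducedPartition us) (inducedPartition ts) ≡ gt → cmpT (node us) (node ts) ≡ gt
cmpT-node-> {us} {ts} same partition> =
  trans (cmpT-node us ts same) (cong (λ o → thenCmp o (lexWith cmpT (sortedChildren us) (sortedChildren ts))) partition>)

-- Dominance of everywhere exhausted trees

Dominates : Tree → Tree → Set
Dominates Z T = cmpT Z T ≡ gt ⊎ (cmpT Z T ≡ eq × Every Exhausted T)

DominatedByExhausted : Tree → Set
DominatedByExhausted T = ∀ {Z} → WF Z → Every Exhausted Z → leaves Z ≡ leaves T → Dominates Z T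

lexWith-dominates : ∀ {Zs Ts} → All DominatedByExhausted Ts → All WF Zs → All (Every Exhausted) Zs →
                    map leaves Zs ≡ map leaves Ts →
                    lexWith cmpT Zs Ts ≡ gt ⊎ (lexWith cmpT Zs Ts ≡ eq × All (Every Exhausted) Ts)
lexWith-dominates {[]} {[]} [] [] [] _ = inj₂ (refl , [])
lexWith-dominates {Z ∷ Zs} {T ∷ Ts} (T-dominated ∷ Ts-dominated) (wZ ∷ wZs) (eZ ∷ eZs) same
  with T-dominated wZ eZ (∷-injectiveˡ same)
... | inj₁ Z>T rewrite Z>T = inj₁ refl
... | inj₂ (Z∼T , eT) rewrite Z∼T =
  Sum.map₂ (Product.map₂ (eT ∷_)) (lexWith-dominates Ts-dominated wZs eZs (∷-injectiveʳ same))

dominates-node : ∀ {zs ts} → WF (node ts) → All DominatedByExhausted ts → All WF zs → All (Every Exhausted) zs →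
                 inducedPartition zs ≡ halves (leavesL ts) → leavesL zs ≡ leavesL ts → Dominates (node zs) (node ts)
dominates-node {zs} {ts} wT ts-dominated wzs zs-exhausted zs-halves same
  with halves-greatest (inducedPartition-isPartition wT)
... | inj₂ halves>ts = inj₁ (cmpT-node-> {zs} {ts} same (subst (λ p → lexWith cmpℕ p _ ≡ gt) (sym zs-halves) halves>ts))
... | inj₁ ts-halves =
  Sum.map (trans same-cmp) (λ (Z∼T , eT) → trans same-cmp Z∼T , everyNode ts-halves (All-sortWith⁻ cmpT eT))
    (lexWith-dominates (All-sortWith⁺ cmpT ts-dominated) (All-sortWith⁺ cmpT wzs) (All-sortWith⁺ cmpT zs-exhausted)
                       (trans zs-halves (sym ts-halves)))
  where
  same-cmp : cmpT (node zs) (node ts) ≡ lexWith cmpT (sortedChildren zs) (sortedChildren ts)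
  same-cmp = cmpT-node-≡ {zs} {ts} (trans zs-halves (sym ts-halves))

mutual
  exhausted-dominates : ∀ {T} → WF T → DominatedByExhausted T
  exhausted-dominates wfLeaf {leaf} _ _ _ = inj₂ (refl , everyLeaf tt)
  exhausted-dominates wfLeaf {node _} wZ _ same = ⊥-elim (node-leaves≢1 wZ same)
  exhausted-dominates wT@(wfNode _ _) {leaf} _ _ same = ⊥-elim (node-leaves≢1 wT (sym same))
  exhausted-dominates wT@(wfNode _ wts) {node zs} (wfNode _ wzs) (everyNode zs-halves zs-exhausted) same =
    dominates-node wT (children-dominated wts) wzs zs-exhausted (trans zs-halves (cong halves same)) same

  children-dominated : ∀ {ts} → All WF ts → All DominatedByExhausted ts
  children-dominated [] = []
  children-dominated (wt ∷ wts) = exhausted-dominates wt ∷ children-dominated wts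

Dominates⇒≤T : ∀ {Z T} → Dominates Z T → T ≤T Z
Dominates⇒≤T {Z} {T} Z≥T T>Z with cmpT Z T | trans (cmpT-flip T Z) (cong flipCmp T>Z) | Z≥T
... | .lt | refl | inj₁ ()
... | .lt | refl | inj₂ (() , _)

-- Balanced trees

balanced : (fuel n : ℕ) → Tree
balanced (suc f) n@(suc (suc _)) = node (balanced f ⌊ n /2⌋ ∷ balanced f ⌈ n /2⌉ ∷ [])
balanced _ _ = leaf

balanced-WF : ∀ f n → WF (balanced f n)
balanced-WF (suc f) (suc (suc m)) = wfNode (s≤s (s≤s z≤n)) (balanced-WF f _ ∷ balanced-WF f _ ∷ [])
balanced-WF zero _ = wfLeaf
balanced-WF (suc f) zero = wfLeaf
balanced-WF (suc f) (suc zero) = wfLeaf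

⌈n/2⌉≤n∸1 : ∀ m → ⌈ suc (suc m) /2⌉ ≤ suc m
⌈n/2⌉≤n∸1 m = ≤-pred (⌈n/2⌉<n m)

balanced-leaves : ∀ f n → 1 ≤ n → n ≤ f → leaves (balanced f n) ≡ n
balanced-leaves (suc f) (suc zero) _ _ = refl
balanced-leaves (suc f) n@(suc (suc m)) _ (s≤s n≤f) =
  trans (cong₂ (λ a b → a + (b + 0)) (balanced-leaves f ⌊ n /2⌋ (s≤s z≤n) (≤-trans (⌊n/2⌋≤⌈n/2⌉ n) ⌈n/2⌉≤f))
                                     (balanced-leaves f ⌈ n /2⌉ (s≤s z≤n) ⌈n/2⌉≤f))
        (trans (cong (⌊ n /2⌋ +_) (+-identityʳ _)) (⌊n/2⌋+⌈n/2⌉≡n n))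
  where
  ⌈n/2⌉≤f : ⌈ n /2⌉ ≤ f
  ⌈n/2⌉≤f = ≤-trans (⌈n/2⌉≤n∸1 m) n≤f

inducedPartition-pair : ∀ {x y} → leaves x ≤ leaves y → inducedPartition (x ∷ y ∷ []) ≡ leaves x ∷ leaves y ∷ []
inducedPartition-pair {x} {y} x≤y with cmpT x y in cxy
... | lt = refl
... | eq = refl
... | gt = cong₂ (λ a b → a ∷ b ∷ []) (sym x≡y) x≡y
  where
  x≡y : leaves x ≡ leaves y
  x≡y = ≤-antisym x≤y (cmpT-≡gt-leaves {x} {y} cxy)

balanced-exhausted : ∀ f n → 1 ≤ n → n ≤ f → Every Exhausted (balanced f n)
balanced-exhausted (suc f) (suc zero) _ _ = everyLeaf tt
balanced-exhausted (suc f) n@(suc (suc m)) 1≤n n≤1+f@(s≤s n≤f) =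
  everyNode exhausted (balanced-exhausted f ⌊ n /2⌋ (s≤s z≤n) ⌊n/2⌋≤f ∷ balanced-exhausted f ⌈ n /2⌉ (s≤s z≤n) ⌈n/2⌉≤f ∷ [])
  where
  ⌈n/2⌉≤f : ⌈ n /2⌉ ≤ f
  ⌈n/2⌉≤f = ≤-trans (⌈n/2⌉≤n∸1 m) n≤f
  ⌊n/2⌋≤f : ⌊ n /2⌋ ≤ f
  ⌊n/2⌋≤f = ≤-trans (⌊n/2⌋≤⌈n/2⌉ n) ⌈n/2⌉≤f
  A = balanced f ⌊ n /2⌋
  B = balanced f ⌈ n /2⌉
  leaves-A : leaves A ≡ ⌊ n /2⌋
  leaves-A = balanced-leaves f ⌊ n /2⌋ (s≤s z≤n) ⌊n/2⌋≤f
  leaves-B : leaves B ≡ ⌈ n /2⌉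
  leaves-B = balanced-leaves f ⌈ n /2⌉ (s≤s z≤n) ⌈n/2⌉≤f
  exhausted : inducedPartition (A ∷ B ∷ []) ≡ halves (leavesL (A ∷ B ∷ []))
  exhausted = begin
    inducedPartition (A ∷ B ∷ [])   ≡⟨ inducedPartition-pair A≤B ⟩
    leaves A ∷ leaves B ∷ []        ≡⟨ cong₂ (λ a b → a ∷ b ∷ []) leaves-A leaves-B ⟩
    halves n                        ≡⟨ cong halves (sym (balanced-leaves (suc f) n 1≤n n≤1+f)) ⟩
    halves (leavesL (A ∷ B ∷ []))   ∎
    where
    open ≡-Reasoning
    A≤B : leaves A ≤ leaves B
    A≤B = subst₂ _≤_ (sym leaves-A) (sym leaves-B) (⌊n/2⌋≤⌈n/2⌉ n)

lemma2 : (n : ℕ) → 1 ≤ n → (T : Tree) → WF T → leaves T ≡ n →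
         ((∀ (T′ : Tree) → WF T′ → leaves T′ ≡ n → T′ ≤T T) ⇔ Every Exhausted T)
lemma2 n 1≤n T wT leaves≡n = mk⇔ maximum⇒exhausted exhausted⇒maximum
  where
  wB : WF (balanced n n)
  wB = balanced-WF n n
  leaves-B : leaves (balanced n n) ≡ n
  leaves-B = balanced-leaves n n 1≤n ≤-refl

  maximum⇒exhausted : (∀ T′ → WF T′ → leaves T′ ≡ n → T′ ≤T T) → Every Exhausted T
  maximum⇒exhausted T-maximum
    with exhausted-dominates wT wB (balanced-exhausted n n 1≤n ≤-refl) (trans leaves-B (sym leaves≡n))
  ... | inj₁ B>T = ⊥-elim (T-maximum (balanced n n) wB leaves-B B>T)
  ... | inj₂ (_ , T-exhausted) = T-exhausted

  exhausted⇒maximum : Every Exhausted T → ∀ T′ → WF T′ → leaves T′ ≡ n → T′ ≤T T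
  exhausted⇒maximum T-exhausted T′ wT′ leaves′≡n =
    Dominates⇒≤T (exhausted-dominates wT′ wT T-exhausted (trans leaves≡n (sym leaves′≡n)))
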